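{- Let $A,B$ be non-empty sets, $I$ a non-empty index set, $\{V_i\}_{i\in I}\subseteq\mathcal{R}(A)$, $\{W_i\}_{i\in I}\subseteq\mathcal{R}(B)$, $Z\in\mathcal{R}(A,B)$. For each $t\in\{1,\dots,6\}$ the heterogeneous weakly linear system $WL^{2\text{ - }t}(A,B,I,V_i,W_i,Z)$ has a greatest solution (which may be the empty relation, identically $0$). Moreover, if $Z$ is a partial fuzzy function, then the greatest solutions to $WL^{2\text{ - }3}(A,B,I,V_i,W_i,Z)$ and $WL^{2\text{ - }4}(A,B,I,V_i,W_i,Z)$ are partial fuzzy functions.
   Context: $\mathcal{L}=(L,\wedge,\vee,\otimes,\to,0,1)$ is a complete residuated lattice ($(L,\wedge,\vee,0,1)$ complete lattice with bounds $0,1$, $(L,\otimes,1)$ commutative monoid, $x\otimes y\le z\iff x\le y\to z$); $x\leftrightarrow y=(x\to y)\wedge(y\to x)$. $\mathcal{R}(A,B)$ is the set of fuzzy relations $A\times B\to L$ ordered pointwise, $\mathcal{R}(A)=\mathcal{R}(A,A)$; $R^{ -1}(b,a)=R(a,b)$; $(R\circ S)(a,c)=\bigvee_b R(a,b)\otimes S(b,c)$. With unknown $U\in\mathcal{R}(A,B)$ the systems are: $WL^{2\text{ - }1}$: $U^{ -1}\circ V_i\le W_i\circ U^{ -1}$ $(i\in I)$, $U\le Z$; $WL^{2\text{ - }2}$: $V_i\circ U\le U\circ W_i$ $(i\in I)$, $U\le Z$; $WL^{2\text{ - }3}$: $U^{ -1}\circ V_i\le W_i\circ U^{ -1}$, $U\circ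 W_i\le V_i\circ U$ $(i\in I)$, $U\le Z$; $WL^{2\text{ - }4}$: $V_i\circ U\le U\circ W_i$, $W_i\circ U^{ -1}\le U^{ -1}\circ V_i$ $(i\in I)$, $U\le Z$; $WL^{2\text{ - }5}$: $V_i\circ U=U\circ W_i$ $(i\in I)$, $U\le Z$; $WL^{2\text{ - }6}$: $U^{ -1}\circ V_i=W_i\circ U^{ -1}$ $(i\in I)$, $U\le Z$. For $R\in\mathcal{R}(A,B)$, its kernel $E_A^R\in\mathcal{R}(A)$ and co-kernel $E_B^R\in\mathcal{R}(B)$ are $E_A^R(a_1,a_2)=\bigwedge_{b\in B}(R(a_1,b)\leftrightarrow R(a_2,b))$ and $E_B^R(b_1,b_2)=\bigwedge_{a\in A}(R(a,b_1)\leftrightarrow R(a,b_2))$. $R$ is a partial fuzzy function if $R(a_1,b)\otimes E_A^R(a_1,a_2)\le R(a_2,b)$, $R(a,b_1)\otimes E_B^R(b_1,b_2)\le R(a,b_2)$ and $R(a,b_1)\otimes R(a,b_2)\le E_B^R(b_1,b_2)$ for all $a,a_1,a_2\in A$, $b,b_1,b_2\in B$. -}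

module Defs where

open import Level using (Level; suc)
open import Relation.Binary.PropositionalEquality using (_≡_)
open import Relation.Binary.Structures using (IsPartialOrder)
open import Data.Product using (_×_; Σ)

-- Arbitrary meets/joins exist for all families indexed by types in
-- the universe Set ℓ (the same universe as the carrier and the sets A, B, I).
record CompleteResiduatedLattice (ℓ : Level) : Set (suc ℓ) where
  infixr 7 _⊗_
  infixr 6 _∧_
  infixr 5 _∨_
  infixr 4 _⇒_
  infix 3 _≤_
  field
    Carrier        : Set ℓ
    _≤_            : Carrier → Carrier → Set ℓ
    isPartialOrder : IsPartialOrder _≡_ _≤_
    _∧_ _∨_        : Carrier → Carrier → Carrier
    ∧-lowerˡ       : ∀ x y → x ∧ y ≤ x
    ∧-lowerʳ       : ∀ x y → x ∧ y ≤ y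
    ∧-greatest     : ∀ x y z → z ≤ x → z ≤ y → z ≤ x ∧ y
    ∨-upperˡ       : ∀ x y → x ≤ x ∨ y
    ∨-upperʳ       : ∀ x y → y ≤ x ∨ y
    ∨-least        : ∀ x y z → x ≤ z → y ≤ z → x ∨ y ≤ z
    𝟘 𝟙            : Carrier
    𝟘-min          : ∀ x → 𝟘 ≤ x
    𝟙-max          : ∀ x → x ≤ 𝟙
    ⋀ ⋁            : {X : Set ℓ} → (X → Carrier) → Carrier
    ⋀-lower        : ∀ {X : Set ℓ} (f : X → Carrier) (x : X) → ⋀ f ≤ f x
    ⋀-greatest     : ∀ {X : Set ℓ} (f : X → Carrier) (c : Carrier) →
                       (∀ x → c ≤ f x) → c ≤ ⋀ f
    ⋁-upper        : ∀ {X : Set ℓ} (f : X → Carrier) (x : X) → f x ≤ ⋁ f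
    ⋁-least        : ∀ {X : Set ℓ} (f : X → Carrier) (c : Carrier) →
                       (∀ x → f x ≤ c) → ⋁ f ≤ c
    _⊗_            : Carrier → Carrier → Carrier
    ⊗-assoc        : ∀ x y z → (x ⊗ y) ⊗ z ≡ x ⊗ (y ⊗ z)
    ⊗-comm         : ∀ x y → x ⊗ y ≡ y ⊗ x
    ⊗-identityˡ    : ∀ x → 𝟙 ⊗ x ≡ x
    _⇒_            : Carrier → Carrier → Carrier
    residuated     : ∀ x y z → (x ⊗ y ≤ z → x ≤ y ⇒ z) × (x ≤ y ⇒ z → x ⊗ y ≤ z)

  _⇔_ : Carrier → Carrier → Carrier
  x ⇔ y = (x ⇒ y) ∧ (y ⇒ x)

module FuzzyRel {ℓ : Level} (𝓛 : CompleteResiduatedLattice ℓ) where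
  open CompleteResiduatedLattice 𝓛

  Rel : Set ℓ → Set ℓ → Set ℓ
  Rel A B = A → B → Carrier

  _⊑_ : {A B : Set ℓ} → Rel A B → Rel A B → Set ℓ
  R ⊑ S = ∀ a b → R a b ≤ S a b

  _≐_ : {A B : Set ℓ} → Rel A B → Rel A B → Set ℓ
  R ≐ S = ∀ a b → R a b ≡ S a b

  _⁻¹ : {A B : Set ℓ} → Rel A B → Rel B A
  (R ⁻¹) b a = R a b

  _∘_ : {A B C : Set ℓ} → Rel A B → Rel B C → Rel A C
  _∘_ {B = B} R S a c = ⋁ {X = B} (λ b → R a b ⊗ S b c)

  ∅ : {A B : Set ℓ} → Rel A B
  ∅ a b = 𝟘

  kernel : {A B : Set ℓ} → Rel A B → Rel A A
  kernel {B = B} R a₁ a₂ = ⋀ {X = B} (λ b → R a₁ b ⇔ R a₂ b)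

  cokernel : {A B : Set ℓ} → Rel A B → Rel B B
  cokernel {A = A} R b₁ b₂ = ⋀ {X = A} (λ a → R a b₁ ⇔ R a b₂)

  IsPartialFuzzyFunction : {A B : Set ℓ} → Rel A B → Set ℓ
  IsPartialFuzzyFunction R =
      (∀ a₁ a₂ b → R a₁ b ⊗ kernel R a₁ a₂ ≤ R a₂ b)
    × (∀ a b₁ b₂ → R a b₁ ⊗ cokernel R b₁ b₂ ≤ R a b₂)
    × (∀ a b₁ b₂ → R a b₁ ⊗ R a b₂ ≤ cokernel R b₁ b₂)

  module _ {A B I : Set ℓ} (V : I → Rel A A) (W : I → Rel B B) (Z : Rel A B) where

    WL2-1 : Rel A B → Set ℓ
    WL2-1 U = (∀ i → ((U ⁻¹) ∘ V i) ⊑ (W i ∘ (U ⁻¹))) × (U ⊑ Z)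

    WL2-2 : Rel A B → Set ℓ
    WL2-2 U = (∀ i → (V i ∘ U) ⊑ (U ∘ W i)) × (U ⊑ Z)

    WL2-3 : Rel A B → Set ℓ
    WL2-3 U = (∀ i → ((U ⁻¹) ∘ V i) ⊑ (W i ∘ (U ⁻¹)) × (U ∘ W i) ⊑ (V i ∘ U))
              × (U ⊑ Z)

    WL2-4 : Rel A B → Set ℓ
    WL2-4 U = (∀ i → (V i ∘ U) ⊑ (U ∘ W i) × (W i ∘ (U ⁻¹)) ⊑ ((U ⁻¹) ∘ V i))
              × (U ⊑ Z)

    WL2-5 : Rel A B → Set ℓ
    WL2-5 U = (∀ i → (V i ∘ U) ≐ (U ∘ W i)) × (U ⊑ Z)

    WL2-6 : Rel A B → Set ℓ
    WL2-6 U = (∀ i → ((U ⁻¹) ∘ V i) ≐ (W i ∘ (U ⁻¹))) × (U ⊑ Z)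

  IsGreatestSolution : {A B : Set ℓ} → (Rel A B → Set ℓ) → Rel A B → Set ℓ
  IsGreatestSolution {A} {B} P U = P U × (∀ (U′ : Rel A B) → P U′ → U′ ⊑ U)

  HasGreatestSolution : {A B : Set ℓ} → (Rel A B → Set ℓ) → Set ℓ
  HasGreatestSolution {A} {B} P = Σ (Rel A B) (IsGreatestSolution P)

module Submission where

-- Call a property P of fuzzy relations join-closed if the
-- pointwise join ⋃ F of any family of solutions is again a solution.  A
-- join-closed P has a greatest solution: the join of ALL its solutions.
-- Each system is a conjunction of the bound U ⊑ Z with inequations
-- Φ U ⊑ Ψ U (or equations) between operators built from U by composition
-- with a fixed relation and inversion.  Such operators are monotone and
-- preserve joins, and this makes every one of these (in)equations, and
-- hence every system, join-closed.
--
-- Write U ∘ U⁻¹ ∘ U for the "sandwich" of U.  A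
-- relation lying above its sandwich is a partial fuzzy function, and a
-- partial fuzzy function Z lies above its sandwich.  The inequations of
-- WL²⁻³ and WL²⁻⁴ are intertwining conditions, which are stable under
-- composition; therefore the sandwich of a solution is again a solution
-- (bounded by Z when Z is a partial fuzzy function).  For the greatest
-- solution U this gives U ∘ U⁻¹ ∘ U ⊑ U, so U is a partial fuzzy function.

open import Defs
open import Level using (Level) renaming (suc to lsuc)
open import Data.Product using (_×_; _,_; proj₁; proj₂; Σ)
open import Relation.Binary.PropositionalEquality using (_≡_; sym; cong)
open import Relation.Binary.Structures using (IsPartialOrder)
open import Relation.Binary.Bundles using (Poset)
import Relation.Binary.PropositionalEquality as ≡
import Relation.Binary.Reasoning.PartialOrder as PosetReasoning
import Relation.Binary.Reasoning.Base.Single as SingleRelationReasoning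
open import Relation.Binary.Reasoning.Syntax using (module ⊑-syntax)

module Theory {ℓ : Level} (𝓛 : CompleteResiduatedLattice ℓ) where
  open CompleteResiduatedLattice 𝓛
  open FuzzyRel 𝓛
  open IsPartialOrder isPartialOrder
    using (antisym) renaming (refl to ≤-refl; trans to ≤-trans; reflexive to ≤-reflexive)

  poset : Poset ℓ ℓ ℓ
  poset = record { isPartialOrder = isPartialOrder }

  module ≤-Reasoning = PosetReasoning poset

  ⇒-intro : ∀ {x y z} → x ⊗ y ≤ z → x ≤ y ⇒ z
  ⇒-intro = proj₁ (residuated _ _ _)

  ⇒-elim : ∀ {x y z} → x ≤ y ⇒ z → x ⊗ y ≤ z
  ⇒-elim = proj₂ (residuated _ _ _)

  ⊗-monoˡ : ∀ {x y} z → x ≤ y → x ⊗ z ≤ y ⊗ z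
  ⊗-monoˡ z x≤y = ⇒-elim (≤-trans x≤y (⇒-intro ≤-refl))

  ⊗-monoʳ : ∀ z {x y} → x ≤ y → z ⊗ x ≤ z ⊗ y
  ⊗-monoʳ z {x} {y} x≤y = begin
    z ⊗ x  ≡⟨ ⊗-comm z x ⟩
    x ⊗ z  ≤⟨ ⊗-monoˡ z x≤y ⟩
    y ⊗ z  ≡⟨ ⊗-comm y z ⟩
    z ⊗ y  ∎
    where open ≤-Reasoning

  ⊗-mono : ∀ {x y u v} → x ≤ y → u ≤ v → x ⊗ u ≤ y ⊗ v
  ⊗-mono {y = y} {u = u} x≤y u≤v = ≤-trans (⊗-monoˡ u x≤y) (⊗-monoʳ y u≤v)

  ⇔-elim : ∀ {x y} → x ⊗ (x ⇔ y) ≤ y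
  ⇔-elim {x} {y} = begin
    x ⊗ (x ⇔ y)  ≤⟨ ⊗-monoʳ x (∧-lowerˡ _ _) ⟩
    x ⊗ (x ⇒ y)  ≡⟨ ⊗-comm x _ ⟩
    (x ⇒ y) ⊗ x  ≤⟨ ⇒-elim ≤-refl ⟩
    y            ∎
    where open ≤-Reasoning

  -- Multiplication distributes over arbitrary joins (one inequality is all
  -- that is needed); again a consequence of residuation.
  ⋁-distribʳ : ∀ {X : Set ℓ} (f : X → Carrier) y → ⋁ f ⊗ y ≤ ⋁ (λ x → f x ⊗ y)
  ⋁-distribʳ f y = ⇒-elim (⋁-least f _ (λ x → ⇒-intro (⋁-upper (λ x → f x ⊗ y) x)))

  ⋁-mono : ∀ {X : Set ℓ} {f g : X → Carrier} → (∀ x → f x ≤ g x) → ⋁ f ≤ ⋁ g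
  ⋁-mono {g = g} f≤g = ⋁-least _ _ (λ x → ≤-trans (f≤g x) (⋁-upper g x))

  ⋁-cong : ∀ {X : Set ℓ} {f g : X → Carrier} → (∀ x → f x ≡ g x) → ⋁ f ≡ ⋁ g
  ⋁-cong f≡g = antisym (⋁-mono (λ x → ≤-reflexive (f≡g x)))
                       (⋁-mono (λ x → ≤-reflexive (sym (f≡g x))))

  ⋁-distribˡ : ∀ {X : Set ℓ} y (f : X → Carrier) → y ⊗ ⋁ f ≤ ⋁ (λ x → y ⊗ f x)
  ⋁-distribˡ y f = begin
    y ⊗ ⋁ f              ≡⟨ ⊗-comm y (⋁ f) ⟩
    ⋁ f ⊗ y              ≤⟨ ⋁-distribʳ f y ⟩
    ⋁ (λ x → f x ⊗ y)    ≡⟨ ⋁-cong (λ x → ⊗-comm (f x) y) ⟩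
    ⋁ (λ x → y ⊗ f x)    ∎
    where open ≤-Reasoning

  module _ {A B : Set ℓ} where
    ⊑-refl : {R : Rel A B} → R ⊑ R
    ⊑-refl a b = ≤-refl

    ⊑-trans : {R S T : Rel A B} → R ⊑ S → S ⊑ T → R ⊑ T
    ⊑-trans R⊑S S⊑T a b = ≤-trans (R⊑S a b) (S⊑T a b)

    ⊑-antisym : {R S : Rel A B} → R ⊑ S → S ⊑ R → R ≐ S
    ⊑-antisym R⊑S S⊑R a b = antisym (R⊑S a b) (S⊑R a b)

    ≐⇒⊑ : {R S : Rel A B} → R ≐ S → R ⊑ S
    ≐⇒⊑ R≐S a b = ≤-reflexive (R≐S a b)

    ≐-sym : {R S : Rel A B} → R ≐ S → S ≐ R
    ≐-sym R≐S a b = sym (R≐S a b)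

    ⁻¹-mono : {R S : Rel A B} → R ⊑ S → (R ⁻¹) ⊑ (S ⁻¹)
    ⁻¹-mono R⊑S b a = R⊑S a b

  module ⊑-Reasoning {A B : Set ℓ} where
    open SingleRelationReasoning (_⊑_ {A} {B}) ⊑-refl ⊑-trans public
      hiding (step-∼)
    open ⊑-syntax _IsRelatedTo_ _IsRelatedTo_ ∼-go public

  module _ {A B C : Set ℓ} where
    ∘-mono : {R R′ : Rel A B} {S S′ : Rel B C} → R ⊑ R′ → S ⊑ S′ → (R ∘ S) ⊑ (R′ ∘ S′)
    ∘-mono R⊑R′ S⊑S′ a c = ⋁-mono (λ b → ⊗-mono (R⊑R′ a b) (S⊑S′ b c))

    ∘-monoˡ : {R R′ : Rel A B} (S : Rel B C) → R ⊑ R′ → (R ∘ S) ⊑ (R′ ∘ S)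
    ∘-monoˡ S R⊑R′ = ∘-mono R⊑R′ (⊑-refl {R = S})

    ∘-monoʳ : (R : Rel A B) {S S′ : Rel B C} → S ⊑ S′ → (R ∘ S) ⊑ (R ∘ S′)
    ∘-monoʳ R S⊑S′ = ∘-mono (⊑-refl {R = R}) S⊑S′

    ∘-congˡ : {R R′ : Rel A B} (S : Rel B C) → R ≐ R′ → (R ∘ S) ≐ (R′ ∘ S)
    ∘-congˡ S R≐R′ a c = ⋁-cong (λ b → cong (_⊗ S b c) (R≐R′ a b))

    ∘-inverse : (R : Rel A B) (S : Rel B C) → ((R ∘ S) ⁻¹) ≐ ((S ⁻¹) ∘ (R ⁻¹))
    ∘-inverse R S c a = ⋁-cong (λ b → ⊗-comm (R a b) (S b c))

  module _ {A B C D : Set ℓ} (R : Rel A B) (S : Rel B C) (Q : Rel C D) where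
    ∘-assoc→ : ((R ∘ S) ∘ Q) ⊑ (R ∘ (S ∘ Q))
    ∘-assoc→ a d = ⋁-least _ _ λ c →
      ≤-trans (⋁-distribʳ (λ b → R a b ⊗ S b c) (Q c d)) (⋁-least _ _ λ b → begin
        (R a b ⊗ S b c) ⊗ Q c d  ≡⟨ ⊗-assoc _ _ _ ⟩
        R a b ⊗ (S b c ⊗ Q c d)  ≤⟨ ⊗-monoʳ (R a b) (⋁-upper (λ c → S b c ⊗ Q c d) c) ⟩
        R a b ⊗ (S ∘ Q) b d      ≤⟨ ⋁-upper (λ b → R a b ⊗ (S ∘ Q) b d) b ⟩
        (R ∘ (S ∘ Q)) a d        ∎)
      where open ≤-Reasoning

    ∘-assoc← : (R ∘ (S ∘ Q)) ⊑ ((R ∘ S) ∘ Q)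
    ∘-assoc← a d = ⋁-least _ _ λ b →
      ≤-trans (⋁-distribˡ (R a b) (λ c → S b c ⊗ Q c d)) (⋁-least _ _ λ c → begin
        R a b ⊗ (S b c ⊗ Q c d)  ≡⟨ sym (⊗-assoc _ _ _) ⟩
        (R a b ⊗ S b c) ⊗ Q c d  ≤⟨ ⊗-monoˡ (Q c d) (⋁-upper (λ b → R a b ⊗ S b c) b) ⟩
        (R ∘ S) a c ⊗ Q c d      ≤⟨ ⋁-upper (λ c → (R ∘ S) a c ⊗ Q c d) c ⟩
        ((R ∘ S) ∘ Q) a d        ∎)
      where open ≤-Reasoning

    ∘-assoc : ((R ∘ S) ∘ Q) ≐ (R ∘ (S ∘ Q))
    ∘-assoc = ⊑-antisym ∘-assoc→ ∘-assoc←

  -- Each constraint of WL²⁻³ (resp. WL²⁻⁴) is of the form Lax (resp. Oplax)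
  -- with R ∈ {U, U⁻¹}; both notions are stable under composing the R's.
  module _ {A B : Set ℓ} where
    Lax : Rel A A → Rel A B → Rel B B → Set ℓ
    Lax P R Q = (R ∘ Q) ⊑ (P ∘ R)

    Oplax : Rel A A → Rel A B → Rel B B → Set ℓ
    Oplax P R Q = (P ∘ R) ⊑ (R ∘ Q)

    lax-resp : {P : Rel A A} {R R′ : Rel A B} {Q : Rel B B} → R ≐ R′ → Lax P R Q → Lax P R′ Q
    lax-resp {P} {R} {R′} {Q} R≐R′ lax = begin
      R′ ∘ Q  ⊑⟨ ∘-monoˡ Q (≐⇒⊑ (≐-sym R≐R′)) ⟩
      R ∘ Q   ⊑⟨ lax ⟩
      P ∘ R   ⊑⟨ ∘-monoʳ P (≐⇒⊑ R≐R′) ⟩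
      P ∘ R′  ∎
      where open ⊑-Reasoning

    oplax-resp : {P : Rel A A} {R R′ : Rel A B} {Q : Rel B B} → R ≐ R′ → Oplax P R Q → Oplax P R′ Q
    oplax-resp {P} {R} {R′} {Q} R≐R′ oplax = begin
      P ∘ R′  ⊑⟨ ∘-monoʳ P (≐⇒⊑ (≐-sym R≐R′)) ⟩
      P ∘ R   ⊑⟨ oplax ⟩
      R ∘ Q   ⊑⟨ ∘-monoˡ Q (≐⇒⊑ R≐R′) ⟩
      R′ ∘ Q  ∎
      where open ⊑-Reasoning

  module _ {A B C : Set ℓ} {P : Rel A A} {Q : Rel B B} {O : Rel C C} where
    lax-∘ : {R : Rel A B} {S : Rel B C} → Lax P R Q → Lax Q S O → Lax P (R ∘ S) O
    lax-∘ {R} {S} R-lax S-lax = begin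
      (R ∘ S) ∘ O  ⊑⟨ ∘-assoc→ R S O ⟩
      R ∘ (S ∘ O)  ⊑⟨ ∘-monoʳ R S-lax ⟩
      R ∘ (Q ∘ S)  ⊑⟨ ∘-assoc← R Q S ⟩
      (R ∘ Q) ∘ S  ⊑⟨ ∘-monoˡ S R-lax ⟩
      (P ∘ R) ∘ S  ⊑⟨ ∘-assoc→ P R S ⟩
      P ∘ (R ∘ S)  ∎
      where open ⊑-Reasoning

    oplax-∘ : {R : Rel A B} {S : Rel B C} → Oplax P R Q → Oplax Q S O → Oplax P (R ∘ S) O
    oplax-∘ {R} {S} R-oplax S-oplax = begin
      P ∘ (R ∘ S)  ⊑⟨ ∘-assoc← P R S ⟩
      (P ∘ R) ∘ S  ⊑⟨ ∘-monoˡ S R-oplax ⟩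
      (R ∘ Q) ∘ S  ⊑⟨ ∘-assoc→ R Q S ⟩
      R ∘ (Q ∘ S)  ⊑⟨ ∘-monoʳ R S-oplax ⟩
      R ∘ (S ∘ O)  ⊑⟨ ∘-assoc← R S O ⟩
      (R ∘ S) ∘ O  ∎
      where open ⊑-Reasoning

  module _ {A B : Set ℓ} where
    ⋃ : {X : Set ℓ} → (X → Rel A B) → Rel A B
    ⋃ F a b = ⋁ (λ x → F x a b)

    ⋃-upper : {X : Set ℓ} (F : X → Rel A B) (x : X) → F x ⊑ ⋃ F
    ⋃-upper F x a b = ⋁-upper (λ x → F x a b) x

    ⋃-least : {X : Set ℓ} {F : X → Rel A B} {R : Rel A B} → (∀ x → F x ⊑ R) → ⋃ F ⊑ R
    ⋃-least F⊑R a b = ⋁-least _ _ (λ x → F⊑R x a b)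

    record JoinClosed (P : Rel A B → Set ℓ) : Set (lsuc ℓ) where
      field join-solves : ∀ {X : Set ℓ} (F : X → Rel A B) → (∀ x → P (F x)) → P (⋃ F)
    open JoinClosed public

    join-closed⇒greatest : {P : Rel A B → Set ℓ} → JoinClosed P → HasGreatestSolution P
    join-closed⇒greatest {P} closed =
      ⋃ solution , join-solves closed solution proj₂ , λ U PU → ⋃-upper solution (U , PU)
      where
      solution : Σ (Rel A B) P → Rel A B
      solution = proj₁

    ×-closed : {P Q : Rel A B → Set ℓ} →
      JoinClosed P → JoinClosed Q → JoinClosed (λ U → P U × Q U)
    ×-closed P-closed Q-closed .join-solves F PQ =
      join-solves P-closed F (λ x → proj₁ (PQ x)) , join-solves Q-closed F (λ x → proj₂ (PQ x))

    ∀-closed : {I : Set ℓ} {P : I → Rel A B → Set ℓ} →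
      (∀ i → JoinClosed (P i)) → JoinClosed (λ U → ∀ i → P i U)
    ∀-closed P-closed .join-solves F P i = join-solves (P-closed i) F (λ x → P x i)

    bounded-closed : (Z : Rel A B) → JoinClosed (_⊑ Z)
    bounded-closed Z .join-solves F = ⋃-least

  module _ {A B C D : Set ℓ} where
    Monotone : (Rel A B → Rel C D) → Set ℓ
    Monotone Φ = ∀ {R S} → R ⊑ S → Φ R ⊑ Φ S

    PreservesJoins : (Rel A B → Rel C D) → Set (lsuc ℓ)
    PreservesJoins Φ = ∀ {X : Set ℓ} (F : X → Rel A B) → Φ (⋃ F) ⊑ ⋃ (λ x → Φ (F x))

    inequation-closed : {Φ Ψ : Rel A B → Rel C D} →
      PreservesJoins Φ → Monotone Ψ → JoinClosed (λ U → Φ U ⊑ Ψ U)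
    inequation-closed {Φ} {Ψ} Φ-joins Ψ-mono .join-solves F solves = begin
      Φ (⋃ F)            ⊑⟨ Φ-joins F ⟩
      ⋃ (λ x → Φ (F x))  ⊑⟨ ⋃-least (λ x → ⊑-trans (solves x) (Ψ-mono (⋃-upper F x))) ⟩
      Ψ (⋃ F)            ∎
      where open ⊑-Reasoning

    equation-closed : {Φ Ψ : Rel A B → Rel C D} →
      PreservesJoins Φ → Monotone Φ → PreservesJoins Ψ → Monotone Ψ → JoinClosed (λ U → Φ U ≐ Ψ U)
    equation-closed {Φ} {Ψ} Φ-joins Φ-mono Ψ-joins Ψ-mono .join-solves F solves = ⊑-antisym
      (join-solves (inequation-closed {Φ = Φ} {Ψ} Φ-joins Ψ-mono) F (λ x → ≐⇒⊑ (solves x)))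
      (join-solves (inequation-closed {Φ = Ψ} {Φ} Ψ-joins Φ-mono) F (λ x → ≐⇒⊑ (≐-sym (solves x))))

  module _ {A B C : Set ℓ} where
    ∘ˡ-preservesJoins : (R : Rel C A) → PreservesJoins {A} {B} (R ∘_)
    ∘ˡ-preservesJoins R F c b = ⋁-least _ _ λ a →
      ≤-trans (⋁-distribˡ (R c a) (λ x → F x a b))
              (⋁-mono (λ x → ⋁-upper (λ a → R c a ⊗ F x a b) a))

    ∘ʳ-preservesJoins : (S : Rel B C) → PreservesJoins {A} {B} (_∘ S)
    ∘ʳ-preservesJoins S F a c = ⋁-least _ _ λ b →
      ≤-trans (⋁-distribʳ (λ x → F x a b) (S b c))
              (⋁-mono (λ x → ⋁-upper (λ b → F x a b ⊗ S b c) b))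

  module _ {A B C D : Set ℓ} {Φ : Rel B A → Rel C D} where
    ⁻¹-preservesJoins : PreservesJoins Φ → PreservesJoins (λ (U : Rel A B) → Φ (U ⁻¹))
    ⁻¹-preservesJoins Φ-joins F = Φ-joins (λ x → F x ⁻¹)

    ⁻¹-monotone : Monotone Φ → Monotone (λ (U : Rel A B) → Φ (U ⁻¹))
    ⁻¹-monotone Φ-mono R⊑S = Φ-mono (⁻¹-mono R⊑S)

  module _ {A B : Set ℓ} where
    sandwich : Rel A B → Rel A B
    sandwich U = U ∘ ((U ⁻¹) ∘ U)

    sandwich-mono : {R S : Rel A B} → R ⊑ S → sandwich R ⊑ sandwich S
    sandwich-mono R⊑S = ∘-mono R⊑S (∘-mono (⁻¹-mono R⊑S) R⊑S)

    sandwich-inverse : (U : Rel A B) → (sandwich U ⁻¹) ≐ ((U ⁻¹) ∘ (U ∘ (U ⁻¹)))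
    sandwich-inverse U b a = begin
      (sandwich U ⁻¹) b a                ≡⟨ ∘-inverse U ((U ⁻¹) ∘ U) b a ⟩
      ((((U ⁻¹) ∘ U) ⁻¹) ∘ (U ⁻¹)) b a  ≡⟨ ∘-congˡ (U ⁻¹) (∘-inverse (U ⁻¹) U) b a ⟩
      (((U ⁻¹) ∘ U) ∘ (U ⁻¹)) b a        ≡⟨ ∘-assoc (U ⁻¹) U (U ⁻¹) b a ⟩
      ((U ⁻¹) ∘ (U ∘ (U ⁻¹))) b a        ∎
      where open ≡.≡-Reasoning

    kernel-compatible : (R : Rel A B) → ∀ a₁ a₂ b → R a₁ b ⊗ kernel R a₁ a₂ ≤ R a₂ b
    kernel-compatible R a₁ a₂ b = ≤-trans (⊗-monoʳ _ (⋀-lower _ b)) ⇔-elim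

    cokernel-compatible : (R : Rel A B) → ∀ a b₁ b₂ → R a b₁ ⊗ cokernel R b₁ b₂ ≤ R a b₂
    cokernel-compatible R a b₁ b₂ = ≤-trans (⊗-monoʳ _ (⋀-lower _ a)) ⇔-elim

    -- A relation above its sandwich satisfies the third clause: a zigzag
    -- a′ —b— a —b′ through R is bounded by R a′ b′.
    functional-if-sandwich : {R : Rel A B} → sandwich R ⊑ R →
      ∀ a b₁ b₂ → R a b₁ ⊗ R a b₂ ≤ cokernel R b₁ b₂
    functional-if-sandwich {R} sandwich⊑R a b₁ b₂ = ⋀-greatest _ _ λ a′ →
      ∧-greatest _ _ _ (⇒-intro (zigzag a′ b₁ b₂))
                       (⇒-intro (≤-trans (⊗-monoˡ _ (≤-reflexive (⊗-comm _ _))) (zigzag a′ b₂ b₁)))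
      where
      zigzag : ∀ a′ b b′ → (R a b ⊗ R a b′) ⊗ R a′ b ≤ R a′ b′
      zigzag a′ b b′ = begin
        (R a b ⊗ R a b′) ⊗ R a′ b  ≡⟨ ⊗-comm _ _ ⟩
        R a′ b ⊗ (R a b ⊗ R a b′)  ≤⟨ ⊗-monoʳ _ (⋁-upper (λ a → R a b ⊗ R a b′) a) ⟩
        R a′ b ⊗ ((R ⁻¹) ∘ R) b b′ ≤⟨ ⋁-upper (λ b → R a′ b ⊗ ((R ⁻¹) ∘ R) b b′) b ⟩
        sandwich R a′ b′           ≤⟨ sandwich⊑R a′ b′ ⟩
        R a′ b′                    ∎
        where open ≤-Reasoning

    pff-if-sandwich : {R : Rel A B} → sandwich R ⊑ R → IsPartialFuzzyFunction R
    pff-if-sandwich {R} sandwich⊑R =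
      kernel-compatible R , cokernel-compatible R , functional-if-sandwich sandwich⊑R

    sandwich-if-pff : {Z : Rel A B} → IsPartialFuzzyFunction Z → sandwich Z ⊑ Z
    sandwich-if-pff {Z} (_ , compatible , functional) a′ b′ = ⋁-least _ _ λ b → begin
      Z a′ b ⊗ ((Z ⁻¹) ∘ Z) b b′  ≤⟨ ⊗-monoʳ _ (⋁-least _ _ (λ a → functional a b b′)) ⟩
      Z a′ b ⊗ cokernel Z b b′    ≤⟨ compatible a′ b b′ ⟩
      Z a′ b′                     ∎
      where open ≤-Reasoning

    sandwich-bounded : {U Z : Rel A B} → IsPartialFuzzyFunction Z → U ⊑ Z → sandwich U ⊑ Z
    sandwich-bounded Z-pff U⊑Z = ⊑-trans (sandwich-mono U⊑Z) (sandwich-if-pff Z-pff)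

    greatest-pff : {P : Rel A B → Set ℓ} → (∀ U → P U → P (sandwich U)) →
      ∀ U → IsGreatestSolution P U → IsPartialFuzzyFunction U
    greatest-pff sandwich-closed U (solves , greatest) =
      pff-if-sandwich (greatest (sandwich U) (sandwich-closed U solves))

  module Systems {A B I : Set ℓ} (V : I → Rel A A) (W : I → Rel B B) (Z : Rel A B) where
    U⁻¹∘V⊑W∘U⁻¹-closed : ∀ i → JoinClosed (λ U → ((U ⁻¹) ∘ V i) ⊑ (W i ∘ (U ⁻¹)))
    U⁻¹∘V⊑W∘U⁻¹-closed i =
      inequation-closed (⁻¹-preservesJoins {Φ = _∘ V i} (∘ʳ-preservesJoins (V i)))
                        (⁻¹-monotone {Φ = W i ∘_} (∘-monoʳ (W i)))

    W∘U⁻¹⊑U⁻¹∘V-closed : ∀ i → JoinClosed (λ U → (W i ∘ (U ⁻¹)) ⊑ ((U ⁻¹) ∘ V i))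
    W∘U⁻¹⊑U⁻¹∘V-closed i =
      inequation-closed (⁻¹-preservesJoins {Φ = W i ∘_} (∘ˡ-preservesJoins (W i)))
                        (⁻¹-monotone {Φ = _∘ V i} (∘-monoˡ (V i)))

    V∘U⊑U∘W-closed : ∀ i → JoinClosed (λ U → (V i ∘ U) ⊑ (U ∘ W i))
    V∘U⊑U∘W-closed i = inequation-closed (∘ˡ-preservesJoins (V i)) (∘-monoˡ (W i))

    U∘W⊑V∘U-closed : ∀ i → JoinClosed (λ U → (U ∘ W i) ⊑ (V i ∘ U))
    U∘W⊑V∘U-closed i = inequation-closed (∘ʳ-preservesJoins (W i)) (∘-monoʳ (V i))

    V∘U≐U∘W-closed : ∀ i → JoinClosed (λ U → (V i ∘ U) ≐ (U ∘ W i))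
    V∘U≐U∘W-closed i = equation-closed (∘ˡ-preservesJoins (V i)) (∘-monoʳ (V i))
                                       (∘ʳ-preservesJoins (W i)) (∘-monoˡ (W i))

    U⁻¹∘V≐W∘U⁻¹-closed : ∀ i → JoinClosed (λ U → ((U ⁻¹) ∘ V i) ≐ (W i ∘ (U ⁻¹)))
    U⁻¹∘V≐W∘U⁻¹-closed i = equation-closed
      (⁻¹-preservesJoins {Φ = _∘ V i} (∘ʳ-preservesJoins (V i)))
      (⁻¹-monotone {Φ = _∘ V i} (∘-monoˡ (V i)))
      (⁻¹-preservesJoins {Φ = W i ∘_} (∘ˡ-preservesJoins (W i)))
      (⁻¹-monotone {Φ = W i ∘_} (∘-monoʳ (W i)))

    WL2-1-closed : JoinClosed (WL2-1 V W Z)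
    WL2-1-closed = ×-closed (∀-closed U⁻¹∘V⊑W∘U⁻¹-closed) (bounded-closed Z)

    WL2-2-closed : JoinClosed (WL2-2 V W Z)
    WL2-2-closed = ×-closed (∀-closed V∘U⊑U∘W-closed) (bounded-closed Z)

    WL2-3-closed : JoinClosed (WL2-3 V W Z)
    WL2-3-closed = ×-closed
      (∀-closed λ i → ×-closed (U⁻¹∘V⊑W∘U⁻¹-closed i) (U∘W⊑V∘U-closed i)) (bounded-closed Z)

    WL2-4-closed : JoinClosed (WL2-4 V W Z)
    WL2-4-closed = ×-closed
      (∀-closed λ i → ×-closed (V∘U⊑U∘W-closed i) (W∘U⁻¹⊑U⁻¹∘V-closed i)) (bounded-closed Z)

    WL2-5-closed : JoinClosed (WL2-5 V W Z)
    WL2-5-closed = ×-closed (∀-closed V∘U≐U∘W-closed) (bounded-closed Z)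

    WL2-6-closed : JoinClosed (WL2-6 V W Z)
    WL2-6-closed = ×-closed (∀-closed U⁻¹∘V≐W∘U⁻¹-closed) (bounded-closed Z)

    -- In WL²⁻³ the constraints say Lax W U⁻¹ (V i) and Lax V U (W i); composing
    -- them along U ∘ U⁻¹ ∘ U and U⁻¹ ∘ U ∘ U⁻¹ shows the sandwich solves it too.
    WL2-3-sandwich : IsPartialFuzzyFunction Z → ∀ U → WL2-3 V W Z U → WL2-3 V W Z (sandwich U)
    WL2-3-sandwich Z-pff U (constraints , U⊑Z) =
      (λ i → let inverse-lax , lax = constraints i in
          lax-resp (≐-sym (sandwich-inverse U)) (lax-∘ inverse-lax (lax-∘ lax inverse-lax))
        , lax-∘ lax (lax-∘ inverse-lax lax))
      , sandwich-bounded Z-pff U⊑Z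

    -- Dually for WL²⁻⁴, whose constraints are Oplax.
    WL2-4-sandwich : IsPartialFuzzyFunction Z → ∀ U → WL2-4 V W Z U → WL2-4 V W Z (sandwich U)
    WL2-4-sandwich Z-pff U (constraints , U⊑Z) =
      (λ i → let oplax , inverse-oplax = constraints i in
          oplax-∘ oplax (oplax-∘ inverse-oplax oplax)
        , oplax-resp (≐-sym (sandwich-inverse U))
                     (oplax-∘ inverse-oplax (oplax-∘ oplax inverse-oplax)))
      , sandwich-bounded Z-pff U⊑Z

theorem4p4 : ∀ {ℓ : Level} (𝓛 : CompleteResiduatedLattice ℓ) → let open FuzzyRel 𝓛 in
    {A B I : Set ℓ} → A → B → I →
    (V : I → Rel A A) (W : I → Rel B B) (Z : Rel A B) →
      ( HasGreatestSolution (WL2-1 V W Z)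
      × HasGreatestSolution (WL2-2 V W Z)
      × HasGreatestSolution (WL2-3 V W Z)
      × HasGreatestSolution (WL2-4 V W Z)
      × HasGreatestSolution (WL2-5 V W Z)
      × HasGreatestSolution (WL2-6 V W Z) )
    × ( IsPartialFuzzyFunction Z →
          (∀ U → IsGreatestSolution (WL2-3 V W Z) U → IsPartialFuzzyFunction U)
        × (∀ U → IsGreatestSolution (WL2-4 V W Z) U → IsPartialFuzzyFunction U) )
theorem4p4 𝓛 _ _ _ V W Z =
    ( join-closed⇒greatest WL2-1-closed
    , join-closed⇒greatest WL2-2-closed
    , join-closed⇒greatest WL2-3-closed
    , join-closed⇒greatest WL2-4-closed
    , join-closed⇒greatest WL2-5-closed
    , join-closed⇒greatest WL2-6-closed )
  , λ Z-pff → greatest-pff (WL2-3-sandwich Z-pff) , greatest-pff (WL2-4-sandwich Z-pff)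
  where
  open Theory 𝓛
  open Systems V W Z
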